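{- Let $\Psi$ be an operator on neutrosophic relations and $\Theta$ an operator on fuzzy relations, both with signature $\langle\Sigma_1,\ldots,\Sigma_{n+1}\rangle$. If $\Psi$ is a strong generalization of $\Theta$, then $\Psi$ is also a weak generalization of $\Theta$.
   Context: A relation scheme is a finite set of attribute names with nonempty domains; $\tau(\Sigma)$ is the set of tuples on $\Sigma$. $\mathcal F(\Sigma)$: fuzzy relations on $\Sigma$, i.e. maps $\tau(\Sigma)\to[0,1]$. A neutrosophic relation $R$ on $\Sigma$ assigns to each $t\in\tau(\Sigma)$ a pair $\langle R(t)^+,R(t)^-\rangle\in[0,1]^2$; $\mathcal V(\Sigma)$ is the set of these. $R$ is consistent if $R(t)^++R(t)^-\le1$ for all $t$, total if $R(t)^++R(t)^-=1$ for all $t$. For total $R$, $\lambda_\Sigma(R)(t)=R(t)^+$. For consistent $R$, $\mathbf{reps}_\Sigma(R)=\{Q\in\mathcal F(\Sigma): R(t)^+\le Q(t)\le1-R(t)^-\ \forall t\}$. An operator on fuzzy relations with signature $\langle\Sigma_1,\dots,\Sigma_{n+1}\rangle$ is a function $\Theta:\mathcal F(\Sigma_1)\times\cdots\times\mathcal F(\Sigma_n)\to\mathcal F(\Sigma_{n+1})$; an operator on neutrosophic relations is $\Psi:\mathcal V(\Sigma_1)\times\cdots\times\mathcal V(\Sigma_n)\to\mathcal V(\Sigma_{n+1})$. $\mathcal S(\Theta)(M_1,\dots,M_n)=\{\Theta(R_1,\dots,R_n): R_i\in M_i\}$ for sets $M_i\subseteq\mathcal F(\Sigma_i)$. $\Psi$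 is totality preserving if it maps total arguments to a total result; it is a weak generalization of $\Theta$ if it is totality preserving and $\lambda_{\Sigma_{n+1}}(\Psi(R_1,\dots,R_n))=\Theta(\lambda_{\Sigma_1}(R_1),\dots,\lambda_{\Sigma_n}(R_n))$ for all total $R_1,\dots,R_n$. $\Psi$ is consistency preserving if it maps consistent arguments to a consistent result; it is a strong generalization of $\Theta$ if it is consistency preserving and $\mathbf{reps}_{\Sigma_{n+1}}(\Psi(R_1,\dots,R_n))=\mathcal S(\Theta)(\mathbf{reps}_{\Sigma_1}(R_1),\dots,\mathbf{reps}_{\Sigma_n}(R_n))$ for all consistent $R_1,\dots,R_n$.
   Formalization: Fuzzy membership grades and the pairs ⟨R(t)⁺, R(t)⁻⟩ of neutrosophic relations take rational values in [0,1] rather than real ones, so Ψ and Θ act on rational-valued relations. -}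

module Defs where

open import Data.Nat using (ℕ)
open import Data.Fin using (Fin)
open import Data.Product using (Σ; _×_; ∃)
open import Data.Rational using (ℚ; 0ℚ; 1ℚ; _≤_; _+_; _-_)
open import Relation.Binary.PropositionalEquality using (_≡_)

-- Truth values: the unit interval, rendered over the rationals.
InUnit : ℚ → Set
InUnit q = (0ℚ ≤ q) × (q ≤ 1ℚ)

record Scheme : Set₁ where
  field
    arity    : ℕ
    Dom      : Fin arity → Set
    nonempty : (a : Fin arity) → Dom a

open Scheme public

τ : Scheme → Set
τ S = (a : Fin (arity S)) → Dom S a

record FRel (S : Scheme) : Set where
  field
    mem      : τ S → ℚ
    mem-unit : ∀ t → InUnit (mem t)

open FRel public

_≗F_ : ∀ {S} → FRel S → FRel S → Set
Q ≗F Q' = ∀ t → mem Q t ≡ mem Q' t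

record NRel (S : Scheme) : Set where
  field
    pos      : τ S → ℚ
    neg      : τ S → ℚ
    pos-unit : ∀ t → InUnit (pos t)
    neg-unit : ∀ t → InUnit (neg t)

open NRel public

_≗N_ : ∀ {S} → NRel S → NRel S → Set
R ≗N R' = ∀ t → (pos R t ≡ pos R' t) × (neg R t ≡ neg R' t)

Consistent : ∀ {S} → NRel S → Set
Consistent R = ∀ t → pos R t + neg R t ≤ 1ℚ

Total : ∀ {S} → NRel S → Set
Total R = ∀ t → pos R t + neg R t ≡ 1ℚ

λΣ : ∀ {S} → NRel S → FRel S
λΣ R = record { mem = pos R ; mem-unit = pos-unit R }

FSet : Scheme → Set₁
FSet S = FRel S → Set

reps : ∀ {S} → NRel S → FSet S
reps R Q = ∀ t → (pos R t ≤ mem Q t) × (mem Q t ≤ 1ℚ - neg R t)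

_⊆_ : ∀ {S} → FSet S → FSet S → Set
A ⊆ B = ∀ Q → A Q → B Q

_≐_ : ∀ {S} → FSet S → FSet S → Set
A ≐ B = (A ⊆ B) × (B ⊆ A)

record Signature (n : ℕ) : Set₁ where
  field
    arg : Fin n → Scheme
    res : Scheme

open Signature public

FArgs : ∀ {n} → Signature n → Set
FArgs sig = (i : Fin _) → FRel (arg sig i)

NArgs : ∀ {n} → Signature n → Set
NArgs sig = (i : Fin _) → NRel (arg sig i)

-- Operators are (set-theoretic, hence extensional) functions; extensionality
-- w.r.t. pointwise equality of relations is part of the data.
record FOp {n} (sig : Signature n) : Set where
  field
    apply : FArgs sig → FRel (res sig)
    ext   : ∀ (Rs Rs' : FArgs sig) → (∀ i → Rs i ≗F Rs' i) → apply Rs ≗F apply Rs'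

record NOp {n} (sig : Signature n) : Set where
  field
    apply : NArgs sig → NRel (res sig)
    ext   : ∀ (Rs Rs' : NArgs sig) → (∀ i → Rs i ≗N Rs' i) → apply Rs ≗N apply Rs'

open FOp public renaming (apply to applyF; ext to extF)
open NOp public renaming (apply to applyN; ext to extN)

𝓢 : ∀ {n} {sig : Signature n} → FOp sig → ((i : Fin n) → FSet (arg sig i)) → FSet (res sig)
𝓢 {sig = sig} Θ M Q = Σ (FArgs sig) λ Rs → ((∀ i → M i (Rs i)) × (applyF Θ Rs ≗F Q))

TotalityPreserving : ∀ {n} {sig : Signature n} → NOp sig → Set
TotalityPreserving Ψ = ∀ Rs → (∀ i → Total (Rs i)) → Total (applyN Ψ Rs)

ConsistencyPreserving : ∀ {n} {sig : Signature n} → NOp sig → Set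
ConsistencyPreserving Ψ = ∀ Rs → (∀ i → Consistent (Rs i)) → Consistent (applyN Ψ Rs)

WeakGeneralization : ∀ {n} {sig : Signature n} → NOp sig → FOp sig → Set
WeakGeneralization Ψ Θ =
  TotalityPreserving Ψ ×
  (∀ Rs → (∀ i → Total (Rs i)) →
     λΣ (applyN Ψ Rs) ≗F applyF Θ (λ i → λΣ (Rs i)))

StrongGeneralization : ∀ {n} {sig : Signature n} → NOp sig → FOp sig → Set
StrongGeneralization Ψ Θ =
  ConsistencyPreserving Ψ ×
  (∀ Rs → (∀ i → Consistent (Rs i)) →
     reps (applyN Ψ Rs) ≐ 𝓢 Θ (λ i → reps (Rs i)))

{-# OPTIONS --safe #-}
-- For total arguments every reps-set is the singleton {λΣ Rᵢ}, so by strong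
-- generalization reps (Ψ Rs) collapses to the single relation Θ (λΣ R₁, …, λΣ Rₙ).
-- Ψ Rs is consistent, so both its lowest representative t ↦ Ψ(Rs)(t)⁺ and its
-- highest one t ↦ 1 - Ψ(Rs)(t)⁻ lie in that set; their equality is totality of
-- Ψ Rs, and the lowest one being Θ (λΣ R₁, …, λΣ Rₙ) is the weak-generalization equation.
module Submission where

open import Defs
open import Data.Nat using (ℕ)
open import Data.Fin using (Fin)
open import Data.Product using (_,_; proj₁; proj₂)
open import Data.Rational using (1ℚ; _≤_; _+_; _-_; -_)
open import Data.Rational.Properties
  using (+-0-group; ≤-refl; ≤-reflexive; ≤-antisym; +-monoˡ-≤; +-monoʳ-≤; neg-antimono-≤; +-inverseʳ; +-identityʳ)
open import Algebra.Properties.Group +-0-group using (//-rightDividesˡ; //-rightDividesʳ)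
open import Relation.Binary.PropositionalEquality using (_≡_; refl; sym; trans; subst)

p+q≡r⇒r-q≡p : ∀ {p q r} → p + q ≡ r → r - q ≡ p
p+q≡r⇒r-q≡p {p} {q} refl = //-rightDividesʳ q p

r-q≡p⇒p+q≡r : ∀ {p q r} → r - q ≡ p → p + q ≡ r
r-q≡p⇒p+q≡r {q = q} {r} refl = //-rightDividesˡ q r

p+q≤r⇒p≤r-q : ∀ {p q r} → p + q ≤ r → p ≤ r - q
p+q≤r⇒p≤r-q {p} {q} {r} p+q≤r = subst (_≤ r - q) (//-rightDividesʳ q p) (+-monoˡ-≤ (- q) p+q≤r)

InUnit-1- : ∀ {q} → InUnit q → InUnit (1ℚ - q)
InUnit-1- {q} (0≤q , q≤1) =
  subst (_≤ 1ℚ - q) (+-inverseʳ q) (+-monoˡ-≤ (- q) q≤1) ,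
  subst (1ℚ - q ≤_) (+-identityʳ 1ℚ) (+-monoʳ-≤ 1ℚ (neg-antimono-≤ 0≤q))

module _ {S : Scheme} where

  upperRep : NRel S → FRel S
  upperRep R = record { mem = λ t → 1ℚ - neg R t ; mem-unit = λ t → InUnit-1- (neg-unit R t) }

  total⇒consistent : (R : NRel S) → Total R → Consistent R
  total⇒consistent R total t = ≤-reflexive (total t)

  λΣ∈reps : (R : NRel S) → Consistent R → reps R (λΣ R)
  λΣ∈reps R consistent t = ≤-refl , p+q≤r⇒p≤r-q (consistent t)

  upperRep∈reps : (R : NRel S) → Consistent R → reps R (upperRep R)
  upperRep∈reps R consistent t = p+q≤r⇒p≤r-q (consistent t) , ≤-refl

  reps-total⇒≗λΣ : (R : NRel S) {Q : FRel S} → Total R → reps R Q → Q ≗F λΣ R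
  reps-total⇒≗λΣ R total Q∈reps t =
    ≤-antisym (subst (_ ≤_) (p+q≡r⇒r-q≡p (total t)) (proj₂ (Q∈reps t))) (proj₁ (Q∈reps t))

  upperRep≗λΣ⇒total : (R : NRel S) → upperRep R ≗F λΣ R → Total R
  upperRep≗λΣ⇒total R upper≗lower t = r-q≡p⇒p+q≡r (upper≗lower t)

module _ {n : ℕ} {sig : Signature n} where

  𝓢-pointwise-unique : (Θ : FOp sig) {M : (i : Fin n) → FSet (arg sig i)} (Qs : FArgs sig) →
    (∀ i Q → M i Q → Q ≗F Qs i) → ∀ Q → 𝓢 Θ M Q → Q ≗F applyF Θ Qs
  𝓢-pointwise-unique Θ Qs unique Q (Rs , Rs∈M , ΘRs≗Q) t =
    trans (sym (ΘRs≗Q t)) (extF Θ Rs Qs (λ i → unique i (Rs i) (Rs∈M i)) t)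

  strong⇒reps-determined : (Ψ : NOp sig) (Θ : FOp sig) → StrongGeneralization Ψ Θ →
    (Rs : NArgs sig) → (∀ i → Total (Rs i)) →
    ∀ Q → reps (applyN Ψ Rs) Q → Q ≗F applyF Θ (λ i → λΣ (Rs i))
  strong⇒reps-determined Ψ Θ (_ , reps≐𝓢) Rs total Q Q∈reps =
    𝓢-pointwise-unique Θ (λ i → λΣ (Rs i)) (λ i Qᵢ → reps-total⇒≗λΣ (Rs i) {Qᵢ} (total i)) Q
      (proj₁ (reps≐𝓢 Rs (λ i → total⇒consistent (Rs i) (total i))) Q Q∈reps)

mainTheorem9 : (n : ℕ) (sig : Signature n) (Ψ : NOp sig) (Θ : FOp sig) →
    StrongGeneralization Ψ Θ → WeakGeneralization Ψ Θ
mainTheorem9 n sig Ψ Θ strong = totality , agreement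
  where
  module _ (Rs : NArgs sig) (total : ∀ i → Total (Rs i)) where
    P : NRel (res sig)
    P = applyN Ψ Rs

    P-consistent : Consistent P
    P-consistent = proj₁ strong Rs (λ i → total⇒consistent (Rs i) (total i))

    determined : ∀ Q → reps P Q → Q ≗F applyF Θ (λ i → λΣ (Rs i))
    determined = strong⇒reps-determined Ψ Θ strong Rs total

    agreement : λΣ P ≗F applyF Θ (λ i → λΣ (Rs i))
    agreement = determined (λΣ P) (λΣ∈reps P P-consistent)

    totality : Total P
    totality = upperRep≗λΣ⇒total P λ t →
      trans (determined (upperRep P) (upperRep∈reps P P-consistent) t) (sym (agreement t))
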